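{- If $G$ is a connected graph, then $|b_{\rm g}(G) - b_{\rm g}'(G)| \le 1$.
   Context: The burning game on a finite simple graph $G$ is played by two players, Burner and Staller. Each vertex is either burned or unburned, and once burned it stays burned. In round 1 the starting player chooses one unburned vertex and burns it (selection phase only). Each round $t \ge 2$ consists of a spreading phase, in which every unburned vertex with a burned neighbor becomes burned, followed, if unburned vertices remain, by a selection phase in which the player whose turn it is burns one unburned vertex; the two players make the selections alternately. The game ends in the first round in which all vertices are burned (this may happen right after a spreading phase), and its length is the number of that round. Burner wants to minimize the length and Staller to maximize it. $b_{\rm g}(G)$ is the length under optimal play when Burner makes the first selection, and $b_{\rm g}'(G)$ is the length under optimal play when Staller makes the first selection. -}

module Defs where

open import Data.Nat using (ℕ; zero; suc; _⊓_; _⊔_)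
open import Data.Bool using (Bool; true; false; _∨_; if_then_else_; not)
open import Data.Fin using (Fin; _≟_)
open import Data.List using (List; []; _∷_; map; filter; foldr; allFin)
open import Data.Bool.ListAction using (any; all)
open import Relation.Nullary.Decidable using (⌊_⌋)
open import Relation.Binary.PropositionalEquality using (_≡_)

record Graph (n : ℕ) : Set where
  field
    adj    : Fin n → Fin n → Bool
    sym    : ∀ u v → adj u v ≡ adj v u
    irrefl : ∀ v → adj v v ≡ false
open Graph public

data Reachable {n : ℕ} (G : Graph n) : Fin n → Fin n → Set where
  here : ∀ {v} → Reachable G v v
  step : ∀ {u w v} → adj G u w ≡ true → Reachable G w v → Reachable G u v

Connected : {n : ℕ} → Graph n → Set
Connected {n} G = ∀ (u v : Fin n) → Reachable G u v

data Player : Set where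
  Burner Staller : Player

other : Player → Player
other Burner  = Staller
other Staller = Burner

-- Optimal choice among the outcomes of the available moves:
-- Burner minimizes, Staller maximizes (value 0 for an empty list; never used).
opt : Player → List ℕ → ℕ
opt _       []       = 0
opt Burner  (x ∷ xs) = foldr _⊓_ x xs
opt Staller (x ∷ xs) = foldr _⊔_ x xs

BurnSet : ℕ → Set
BurnSet n = Fin n → Bool

module _ {n : ℕ} (G : Graph n) where

  allBurned : BurnSet n → Bool
  allBurned S = all S (allFin n)

  unburned : BurnSet n → List (Fin n)
  unburned S = filter (λ v → not (S v) Data.Bool.≟ true) (allFin n)

  spread : BurnSet n → BurnSet n
  spread S v = S v ∨ any (λ u → adj G u v Data.Bool.∧ S u) (allFin n)

  burn : Fin n → BurnSet n → BurnSet n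
  burn v S u = ⌊ u ≟ v ⌋ ∨ S u

  -- gameFrom k t p S : length of the game under optimal play, when round t
  -- (t ≥ 2) is about to start, the burned set is S (not all burned), and
  -- player p makes the selection of round t.  k is fuel: each round burns at
  -- least one new vertex, so fuel n always suffices (fuel 0 is never reached
  -- from the calls below).
  gameFrom : ℕ → ℕ → Player → BurnSet n → ℕ
  gameFrom zero    t p S = t
  gameFrom (suc k) t p S =
    let S' = spread S in
    if allBurned S' then t
    else opt p (map (λ v → let S'' = burn v S' in
                           if allBurned S'' then t
                           else gameFrom k (suc t) (other p) S'')
                    (unburned S'))

  gameLength : Player → ℕ
  gameLength p =
    opt p (map (λ v → let S = burn v (λ _ → false) in
                      if allBurned S then 1
                      else gameFrom n 2 (other p) S)
               (allFin n))

  -- b_g(G): Burner starts;  b_g'(G): Staller starts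
  bg : ℕ
  bg = gameLength Burner

  bg' : ℕ
  bg' = gameLength Staller

-- Proof idea: the value of the game only decreases when more vertices are burned, and
-- postponing every round by one adds exactly one to it.  Let p open optimally with v.
-- In round 2 the opponent q = other p selects, and q can play as if q were opening a
-- fresh game: q answers with its own optimal opening w, or with any unburned vertex if
-- w is already burned.  Either way the burned set contains the one q would have after
-- opening with w, so the rest of the game is at most the q-opened game delayed by one
-- round.  Hence gameLength p ≤ 1 + gameLength q for both p, i.e. |bg − bg'| ≤ 1.
module Submission where

open import Defs hiding (sym)
open import Data.Nat using (ℕ; zero; suc; _≤_; ∣_-_∣; _⊓_; _⊔_; z≤n; s≤s)
open import Data.Nat.Properties
  using ( module ≤-Reasoning; ≤-refl; ≤-trans; n≤1+n; ⊓-sel; ⊔-sel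
        ; m≤n⇒m⊓o≤n; m≤n⇒o⊓m≤n; m≤n⇒m≤n⊔o; m≤n⇒m≤o⊔n)
open import Data.Bool using (true; false; T; _∧_; if_then_else_)
open import Data.Bool.Properties using (T-∨; T-∧; T?; ¬-not)
open import Data.Fin using (Fin; zero; _≟_)
open import Data.List using (List; _∷_; []; map; allFin)
open import Data.List.Properties using (foldr-map; foldr-fusion; map-cong; map-∘; foldr-preservesᵒ)
open import Data.List.Membership.Propositional using (_∈_; lose; find)
open import Data.List.Membership.Propositional.Properties
  using (∈-map⁺; ∈-map⁻; ∈-filter⁺; ∈-filter⁻; ∈-allFin; foldr-selective)
import Data.List.Relation.Unary.All as All
open import Data.List.Relation.Unary.All.Properties using (all⁺; all⁻; ¬All⇒Any¬)
open import Data.List.Relation.Unary.Any as Any using (here; there)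
open import Data.List.Relation.Unary.Any.Properties using (any⁺; any⁻)
open import Data.Product using (∃-syntax; _×_; _,_; map₂)
open import Data.Sum using (inj₂; [_,_]′) renaming (map to ⊎-map; map₂ to ⊎-map₂)
open import Function using (_∘_; Equivalence)
open import Relation.Nullary using (¬_; yes; no; contradiction)
open import Relation.Binary.PropositionalEquality
  using (_≡_; refl; sym; trans; cong; subst; module ≡-Reasoning)

open Equivalence using (to; from)

∣m-n∣≤1 : ∀ {m n} → m ≤ suc n → n ≤ suc m → ∣ m - n ∣ ≤ 1
∣m-n∣≤1 {zero}          _           n≤1         = n≤1
∣m-n∣≤1 {suc m} {zero}  m≤1         _           = m≤1
∣m-n∣≤1 {suc m} {suc n} (s≤s m≤1+n) (s≤s n≤1+m) = ∣m-n∣≤1 m≤1+n n≤1+m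

opt-∈ : ∀ p x xs → opt p (x ∷ xs) ∈ x ∷ xs
opt-∈ Burner  x xs = [ (λ e → subst (_∈ x ∷ xs) (sym e) (here refl)) , there ]′
                       (foldr-selective {_•_ = _⊓_} ⊓-sel x xs)
opt-∈ Staller x xs = [ (λ e → subst (_∈ x ∷ xs) (sym e) (here refl)) , there ]′
                       (foldr-selective {_•_ = _⊔_} ⊔-sel x xs)

opt-Burner-≤ : ∀ {y} xs → y ∈ xs → opt Burner xs ≤ y
opt-Burner-≤ (x ∷ xs) y∈ =
  foldr-preservesᵒ (λ a b → [ m≤n⇒m⊓o≤n b , m≤n⇒o⊓m≤n a ]′) x xs (Any.toSum (lose y∈ ≤-refl))

opt-Staller-≥ : ∀ {y} xs → y ∈ xs → y ≤ opt Staller xs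
opt-Staller-≥ (x ∷ xs) y∈ =
  foldr-preservesᵒ (λ a b → [ m≤n⇒m≤n⊔o b , m≤n⇒m≤o⊔n a ]′) x xs (Any.toSum (lose y∈ ≤-refl))

opt-suc : ∀ p x xs → opt p (map suc (x ∷ xs)) ≡ suc (opt p (x ∷ xs))
opt-suc Burner  x xs = trans (foldr-map _⊓_ suc (suc x) xs) (sym (foldr-fusion suc x (λ _ _ → refl) xs))
opt-suc Staller x xs = trans (foldr-map _⊔_ suc (suc x) xs) (sym (foldr-fusion suc x (λ _ _ → refl) xs))

module _ {A : Set} where

  opt-map-attained : ∀ p (f : A → ℕ) {v} vs → v ∈ vs → ∃[ w ] w ∈ vs × opt p (map f vs) ≡ f w
  opt-map-attained p f (v ∷ vs) _ = ∈-map⁻ f (opt-∈ p (f v) (map f vs))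

  opt-map-≥ : ∀ p (f : A → ℕ) {t v} vs → v ∈ vs → (∀ {w} → w ∈ vs → t ≤ f w) → t ≤ opt p (map f vs)
  opt-map-≥ p f vs v∈ t≤f with opt-map-attained p f vs v∈
  ... | w , w∈ , eq = subst (_ ≤_) (sym eq) (t≤f w∈)

  opt-map-mono : ∀ p (f g : A → ℕ) vs → (∀ {v} → v ∈ vs → f v ≤ g v) → opt p (map f vs) ≤ opt p (map g vs)
  opt-map-mono p       f g []       f≤g = z≤n
  opt-map-mono Burner  f g (v ∷ vs) f≤g with opt-map-attained Burner g (v ∷ vs) (here refl)
  ... | w , w∈ , eq =
    subst (_ ≤_) (sym eq) (≤-trans (opt-Burner-≤ (map f (v ∷ vs)) (∈-map⁺ f w∈)) (f≤g w∈))
  opt-map-mono Staller f g (v ∷ vs) f≤g with opt-map-attained Staller f (v ∷ vs) (here refl)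
  ... | w , w∈ , eq =
    subst (_≤ _) (sym eq) (≤-trans (f≤g w∈) (opt-Staller-≥ (map g (v ∷ vs)) (∈-map⁺ g w∈)))

  opt-map-suc : ∀ p (f g : A → ℕ) {v} vs → v ∈ vs → (∀ w → g w ≡ suc (f w)) →
                opt p (map g vs) ≡ suc (opt p (map f vs))
  opt-map-suc p f g (v ∷ vs) _ g≗suc∘f = begin
    opt p (map g (v ∷ vs))            ≡⟨ cong (opt p) (map-cong g≗suc∘f (v ∷ vs)) ⟩
    opt p (map (suc ∘ f) (v ∷ vs))    ≡⟨ cong (opt p) (map-∘ (v ∷ vs)) ⟩
    opt p (map suc (map f (v ∷ vs)))  ≡⟨ opt-suc p (f v) (map f vs) ⟩
    suc (opt p (map f (v ∷ vs)))      ∎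
    where open ≡-Reasoning

module _ {n : ℕ} where

  infix 4 _⊆_
  _⊆_ : BurnSet n → BurnSet n → Set
  X ⊆ Y = ∀ v → T (X v) → T (Y v)

  ∅ : BurnSet n
  ∅ _ = false

  ∅-⊆ : ∀ {X} → ∅ ⊆ X
  ∅-⊆ _ ()

  ⊆-trans : ∀ {X Y Z} → X ⊆ Y → Y ⊆ Z → X ⊆ Z
  ⊆-trans XY YZ v = YZ v ∘ XY v

module _ {n : ℕ} (G : Graph n) where

  spread-mono : ∀ {X Y} → X ⊆ Y → spread G X ⊆ spread G Y
  spread-mono {X} {Y} XY v =
    from T-∨ ∘ ⊎-map (XY v) (any⁺ _ ∘ Any.map burnedNeighbour-mono ∘ any⁻ _ (allFin n)) ∘ to T-∨
    where
    burnedNeighbour-mono : ∀ {u} → T (adj G u v ∧ X u) → T (adj G u v ∧ Y u)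
    burnedNeighbour-mono {u} = from T-∧ ∘ map₂ (XY u) ∘ to T-∧

  ⊆-burn : ∀ {X} v → X ⊆ burn G v X
  ⊆-burn v u = from T-∨ ∘ inj₂

  burn-mono : ∀ {X Y} v → X ⊆ Y → burn G v X ⊆ burn G v Y
  burn-mono v XY u = from T-∨ ∘ ⊎-map₂ (XY u) ∘ to T-∨

  burn-⊆ : ∀ {X Y v} → T (Y v) → X ⊆ Y → burn G v X ⊆ Y
  burn-⊆ {v = v} Yv XY u with u ≟ v
  ... | yes refl = λ _ → Yv
  ... | no  _    = XY u

  allBurned-mono : ∀ {X Y} → X ⊆ Y → T (allBurned G X) → T (allBurned G Y)
  allBurned-mono XY = all⁻ _ ∘ All.map (XY _) ∘ all⁺ _ (allFin n)

  ∈-unburned⁺ : ∀ {X v} → ¬ T (X v) → v ∈ unburned G X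
  ∈-unburned⁺ {v = v} ¬Xv = ∈-filter⁺ _ (∈-allFin v) (sym (¬-not (λ true≡Xv → ¬Xv (subst T true≡Xv _))))

  ∈-unburned⁻ : ∀ {X v} → v ∈ unburned G X → ¬ T (X v)
  ∈-unburned⁻ {X} {v} v∈ with X v | ∈-filter⁻ _ {xs = allFin n} v∈
  ... | false | _      = λ ()
  ... | true  | _ , ()

  unburned-antitone : ∀ {X Y v} → X ⊆ Y → v ∈ unburned G Y → v ∈ unburned G X
  unburned-antitone XY = ∈-unburned⁺ ∘ (λ ¬Yv → ¬Yv ∘ XY _) ∘ ∈-unburned⁻

  unburned-nonempty : ∀ {X} → ¬ T (allBurned G X) → ∃[ v ] v ∈ unburned G X
  unburned-nonempty {X} notAll with find (¬All⇒Any¬ (T? ∘ X) (allFin n) (notAll ∘ all⁻ X))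
  ... | v , _ , ¬Xv = v , ∈-unburned⁺ ¬Xv

  -- Up to definitional equality, gameFrom G (suc k) t p S is
  --   if allBurned G (spread G S) then t
  --   else selectionValue p (afterSelection k t p) (spread G S) (unburned G (spread G S))
  -- and gameLength G p is openingValue p n 1.
  afterSelection : ℕ → ℕ → Player → BurnSet n → ℕ
  afterSelection k t p X = if allBurned G X then t else gameFrom G k (suc t) (other p) X

  selectionValue : Player → (BurnSet n → ℕ) → BurnSet n → List (Fin n) → ℕ
  selectionValue p h X vs = opt p (map (λ v → h (burn G v X)) vs)

  openingValue : Player → ℕ → ℕ → ℕ
  openingValue p k t = selectionValue p (afterSelection k t p) ∅ (allFin n)

  mutual
    gameFrom-≥ : ∀ k t p S → t ≤ gameFrom G k t p S
    gameFrom-≥ zero    t p S = ≤-refl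
    gameFrom-≥ (suc k) t p S with allBurned G (spread G S) in eq
    ... | true  = ≤-refl
    ... | false with unburned-nonempty (subst T eq)
    ...   | _ , v∈ = opt-map-≥ p _ _ v∈ (λ _ → afterSelection-≥ k t p _)

    afterSelection-≥ : ∀ k t p X → t ≤ afterSelection k t p X
    afterSelection-≥ k t p X with allBurned G X
    ... | true  = ≤-refl
    ... | false = ≤-trans (n≤1+n t) (gameFrom-≥ k (suc t) (other p) X)

  mutual
    gameFrom-fuel : ∀ k t p S → gameFrom G k t p S ≤ gameFrom G (suc k) t p S
    gameFrom-fuel zero    t p S = gameFrom-≥ 1 t p S
    gameFrom-fuel (suc k) t p S with allBurned G (spread G S)
    ... | true  = ≤-refl
    ... | false = opt-map-mono p _ _ (unburned G (spread G S)) (λ _ → afterSelection-fuel k t p _)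

    afterSelection-fuel : ∀ k t p X → afterSelection k t p X ≤ afterSelection (suc k) t p X
    afterSelection-fuel k t p X with allBurned G X
    ... | true  = ≤-refl
    ... | false = gameFrom-fuel k (suc t) (other p) X

  mutual
    gameFrom-suc-round : ∀ k t p S → gameFrom G k (suc t) p S ≡ suc (gameFrom G k t p S)
    gameFrom-suc-round zero    t p S = refl
    gameFrom-suc-round (suc k) t p S with allBurned G (spread G S) in eq
    ... | true  = refl
    ... | false with unburned-nonempty (subst T eq)
    ...   | _ , v∈ = opt-map-suc p _ _ _ v∈ (λ _ → afterSelection-suc-round k t p _)

    afterSelection-suc-round : ∀ k t p X → afterSelection k (suc t) p X ≡ suc (afterSelection k t p X)
    afterSelection-suc-round k t p X with allBurned G X
    ... | true  = refl
    ... | false = gameFrom-suc-round k (suc t) (other p) X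

  dominating-reply : ∀ {X Y w₀} → X ⊆ Y → w₀ ∈ unburned G Y →
                     ∀ v → ∃[ w ] w ∈ unburned G Y × burn G v X ⊆ burn G w Y
  dominating-reply {Y = Y} {w₀} XY w₀∈ v with T? (Y v)
  ... | yes Yv  = w₀ , w₀∈ , ⊆-trans (burn-⊆ Yv XY) (⊆-burn w₀)
  ... | no  ¬Yv = v , ∈-unburned⁺ ¬Yv , burn-mono v XY

  -- Strategy copying: Burner on Y answers the move optimal on X by a dominating reply;
  -- Staller's optimal move on Y is also available on X.
  selectionValue-copy : ∀ p {X Y w₀} (h h′ : BurnSet n → ℕ) (vs : List (Fin n)) →
    (∀ {X′ Y′} → X′ ⊆ Y′ → h Y′ ≤ h′ X′) → X ⊆ Y → w₀ ∈ unburned G Y →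
    (∀ {w} → w ∈ unburned G Y → w ∈ vs) →
    selectionValue p h Y (unburned G Y) ≤ selectionValue p h′ X vs
  selectionValue-copy Burner {X} h h′ vs h≤h′ XY w₀∈ ⊆vs
    with opt-map-attained Burner (λ v → h′ (burn G v X)) vs (⊆vs w₀∈)
  ... | v , _ , eq with dominating-reply XY w₀∈ v
  ...   | w , w∈ , vX⊆wY =
    subst (_ ≤_) (sym eq) (≤-trans (opt-Burner-≤ _ (∈-map⁺ _ w∈)) (h≤h′ vX⊆wY))
  selectionValue-copy Staller {Y = Y} h h′ vs h≤h′ XY w₀∈ ⊆vs
    with opt-map-attained Staller (λ w → h (burn G w Y)) (unburned G Y) w₀∈
  ... | w , w∈ , eq =
    subst (_≤ _) (sym eq) (≤-trans (h≤h′ (burn-mono w XY)) (opt-Staller-≥ _ (∈-map⁺ _ (⊆vs w∈))))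

  mutual
    gameFrom-antitone : ∀ k t p {X Y} → X ⊆ Y → gameFrom G k t p Y ≤ gameFrom G k t p X
    gameFrom-antitone zero    t p XY = ≤-refl
    gameFrom-antitone (suc k) t p {X} {Y} XY with allBurned G (spread G Y) in eqY
    ... | true  = gameFrom-≥ (suc k) t p X
    ... | false with allBurned G (spread G X) in eqX
    ...   | true  = contradiction (allBurned-mono (spread-mono XY) (subst T (sym eqX) _)) (subst T eqY)
    ...   | false with unburned-nonempty (subst T eqY)
    ...     | _ , w₀∈ = selectionValue-copy p _ _ (unburned G (spread G X)) (afterSelection-antitone k t p)
                          (spread-mono XY) w₀∈ (unburned-antitone (spread-mono XY))

    afterSelection-antitone : ∀ k t p {X Y} → X ⊆ Y → afterSelection k t p Y ≤ afterSelection k t p X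
    afterSelection-antitone k t p {X} {Y} XY with allBurned G Y in eqY
    ... | true  = afterSelection-≥ k t p X
    ... | false with allBurned G X in eqX
    ...   | true  = contradiction (allBurned-mono XY (subst T (sym eqX) _)) (subst T eqY)
    ...   | false = gameFrom-antitone k (suc t) (other p) XY

  afterSelection-delay : ∀ k t p {X Y} → X ⊆ Y →
                         afterSelection k (suc t) p Y ≤ suc (afterSelection (suc k) t p X)
  afterSelection-delay k t p {X} {Y} XY = begin
    afterSelection k (suc t) p Y        ≤⟨ afterSelection-fuel k (suc t) p Y ⟩
    afterSelection (suc k) (suc t) p Y  ≤⟨ afterSelection-antitone (suc k) (suc t) p XY ⟩
    afterSelection (suc k) (suc t) p X  ≡⟨ afterSelection-suc-round (suc k) t p X ⟩
    suc (afterSelection (suc k) t p X)  ∎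
    where open ≤-Reasoning

module _ {m : ℕ} (G : Graph (suc m)) where

  openingValue-≥ : ∀ p k t → t ≤ openingValue G p k t
  openingValue-≥ p k t =
    opt-map-≥ p (λ v → afterSelection G k t p (burn G v ∅)) (allFin (suc m)) (∈-allFin zero)
      (λ _ → afterSelection-≥ G k t p _)

  gameFrom-≤-suc-openingValue : ∀ k t p S → gameFrom G k (suc t) p S ≤ suc (openingValue G p k t)
  gameFrom-≤-suc-openingValue zero    t p S = s≤s (openingValue-≥ p 0 t)
  gameFrom-≤-suc-openingValue (suc k) t p S with allBurned G (spread G S) in eq
  ... | true  = s≤s (openingValue-≥ p (suc k) t)
  ... | false with unburned-nonempty G (subst T eq)
  ...   | _ , w₀∈ = begin
    selectionValue G p (afterSelection G k (suc t) p) (spread G S) (unburned G (spread G S))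
      ≤⟨ selectionValue-copy G p {Y = spread G S} _ _ (allFin (suc m))
           (afterSelection-delay G k t p) ∅-⊆ w₀∈ (λ {w} _ → ∈-allFin w) ⟩
    selectionValue G p (suc ∘ afterSelection G (suc k) t p) ∅ (allFin (suc m))
      ≡⟨ opt-map-suc p _ _ (allFin (suc m)) (∈-allFin zero) (λ _ → refl) ⟩
    suc (openingValue G p (suc k) t) ∎
    where open ≤-Reasoning

  afterOpening-≤-suc-gameLength : ∀ p X → afterSelection G (suc m) 1 p X ≤ suc (gameLength G (other p))
  afterOpening-≤-suc-gameLength p X with allBurned G X
  ... | true  = s≤s z≤n
  ... | false = gameFrom-≤-suc-openingValue (suc m) 1 (other p) X

  gameLength-≤-suc : ∀ p → gameLength G p ≤ suc (gameLength G (other p))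
  gameLength-≤-suc p
    with opt-map-attained p (λ v → afterSelection G (suc m) 1 p (burn G v ∅)) (allFin (suc m)) (∈-allFin zero)
  ... | v , _ , eq =
    subst (_≤ suc (gameLength G (other p))) (sym eq) (afterOpening-≤-suc-gameLength p (burn G v ∅))

proposition2p5 : (n : ℕ) (G : Graph (suc n)) → Connected G → ∣ bg G - bg' G ∣ ≤ 1
proposition2p5 n G _ = ∣m-n∣≤1 (gameLength-≤-suc G Burner) (gameLength-≤-suc G Staller)
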